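{- Let $T$ be an $\omega$-consistent recursively enumerable theory in the language of arithmetic extending Robinson's arithmetic $Q$. Then every $T$-provable $\Pi_3$-sentence is true in $\mathbb{N}$, and every Gödelian sentence of $T$ that is a $\Pi_3$-sentence is true in $\mathbb{N}$.
   Context: $\mathbb{N}$ is the standard model of arithmetic. $T$ is $\omega$-consistent iff there is no formula $\xi(x)$ such that $T\vdash\exists x\neg\xi(x)$ and $T\vdash\xi(\mathbf{n})$ for every natural number $n$ (where $\mathbf{n}$ is the numeral for $n$). $\Pi_3$ refers to the arithmetical hierarchy. For a formula $\sigma$, $\#\sigma$ is the canonical numeral for its Gödel number, and $\mathrm{Pr}_T(x)$ is a standard ($\Sigma_1$) provability predicate for $T$. A sentence $G$ is a Gödelian sentence of $T$ iff $T\vdash G\leftrightarrow\neg\mathrm{Pr}_T(\#G)$. -}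

module Defs where

open import Data.Nat using (ℕ; zero; suc; _+_; _*_)
open import Data.Fin using (Fin; toℕ) renaming (zero to fz; suc to fs)
open import Data.List using (List; []; _∷_; map)
open import Data.List.Membership.Propositional using (_∈_)
open import Data.Product using (Σ; _×_; _,_)
open import Data.Sum using (_⊎_)
open import Data.Empty using (⊥)
open import Data.Unit using (⊤)
open import Relation.Nullary using (¬_)
open import Relation.Binary.PropositionalEquality using (_≡_)

-- Syntax of first-order arithmetic (language 0, S, +, ×), de Bruijn
-- variables: Term n / Formula n have at most n free variables.

infixl 7 _*'_
infixl 6 _+'_
infix  4 _≐_
infixr 3 _∧̇_
infixr 2 _∨̇_
infixr 1 _⇒̇_
infix  0 _⇔̇_
infix  5 ¬̇_

data Term (n : ℕ) : Set where
  var  : Fin n → Term n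
  zer  : Term n
  S    : Term n → Term n
  _+'_ : Term n → Term n → Term n
  _*'_ : Term n → Term n → Term n

data Formula (n : ℕ) : Set where
  _≐_  : Term n → Term n → Formula n
  ⊥̇    : Formula n
  _⇒̇_  : Formula n → Formula n → Formula n
  _∧̇_  : Formula n → Formula n → Formula n
  _∨̇_  : Formula n → Formula n → Formula n
  ∀̇    : Formula (suc n) → Formula n
  ∃̇    : Formula (suc n) → Formula n

¬̇_ : ∀ {n} → Formula n → Formula n
¬̇ φ = φ ⇒̇ ⊥̇

_⇔̇_ : ∀ {n} → Formula n → Formula n → Formula n
φ ⇔̇ ψ = (φ ⇒̇ ψ) ∧̇ (ψ ⇒̇ φ)

Sentence : Set
Sentence = Formula 0

ext : ∀ {m n} → (Fin m → Fin n) → Fin (suc m) → Fin (suc n)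
ext ρ fz     = fz
ext ρ (fs i) = fs (ρ i)

renT : ∀ {m n} → (Fin m → Fin n) → Term m → Term n
renT ρ (var i)  = var (ρ i)
renT ρ zer      = zer
renT ρ (S t)    = S (renT ρ t)
renT ρ (s +' t) = renT ρ s +' renT ρ t
renT ρ (s *' t) = renT ρ s *' renT ρ t

renF : ∀ {m n} → (Fin m → Fin n) → Formula m → Formula n
renF ρ (s ≐ t)  = renT ρ s ≐ renT ρ t
renF ρ ⊥̇        = ⊥̇
renF ρ (φ ⇒̇ ψ)  = renF ρ φ ⇒̇ renF ρ ψ
renF ρ (φ ∧̇ ψ)  = renF ρ φ ∧̇ renF ρ ψ
renF ρ (φ ∨̇ ψ)  = renF ρ φ ∨̇ renF ρ ψ
renF ρ (∀̇ φ)    = ∀̇ (renF (ext ρ) φ)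
renF ρ (∃̇ φ)    = ∃̇ (renF (ext ρ) φ)

wkT : ∀ {n} → Term n → Term (suc n)
wkT = renT fs

wk : ∀ {n} → Formula n → Formula (suc n)
wk = renF fs

exts : ∀ {m n} → (Fin m → Term n) → Fin (suc m) → Term (suc n)
exts σ fz     = var fz
exts σ (fs i) = wkT (σ i)

subT : ∀ {m n} → (Fin m → Term n) → Term m → Term n
subT σ (var i)  = σ i
subT σ zer      = zer
subT σ (S t)    = S (subT σ t)
subT σ (s +' t) = subT σ s +' subT σ t
subT σ (s *' t) = subT σ s *' subT σ t

subF : ∀ {m n} → (Fin m → Term n) → Formula m → Formula n
subF σ (s ≐ t)  = subT σ s ≐ subT σ t
subF σ ⊥̇        = ⊥̇
subF σ (φ ⇒̇ ψ)  = subF σ φ ⇒̇ subF σ ψ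
subF σ (φ ∧̇ ψ)  = subF σ φ ∧̇ subF σ ψ
subF σ (φ ∨̇ ψ)  = subF σ φ ∨̇ subF σ ψ
subF σ (∀̇ φ)    = ∀̇ (subF (exts σ) φ)
subF σ (∃̇ φ)    = ∃̇ (subF (exts σ) φ)

sub0 : ∀ {n} → Term n → Fin (suc n) → Term n
sub0 t fz     = t
sub0 t (fs i) = var i

_[_] : ∀ {n} → Formula (suc n) → Term n → Formula n
φ [ t ] = subF (sub0 t) φ

close : ∀ {n} → Sentence → Formula n
close = renF (λ ())

num : ∀ {n} → ℕ → Term n
num zero    = zer
num (suc k) = S (num k)

_≤̇_ : ∀ {n} → Term n → Term n → Formula n
s ≤̇ u = ∃̇ (var fz +' wkT s ≐ wkT u)

data IsΔ₀ {n : ℕ} : Formula n → Set where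
  eq    : ∀ s t → IsΔ₀ (s ≐ t)
  bot   : IsΔ₀ ⊥̇
  imp   : ∀ {φ ψ} → IsΔ₀ φ → IsΔ₀ ψ → IsΔ₀ (φ ⇒̇ ψ)
  conj  : ∀ {φ ψ} → IsΔ₀ φ → IsΔ₀ ψ → IsΔ₀ (φ ∧̇ ψ)
  disj  : ∀ {φ ψ} → IsΔ₀ φ → IsΔ₀ ψ → IsΔ₀ (φ ∨̇ ψ)
  ball  : ∀ (t : Term n) {φ} → IsΔ₀ φ → IsΔ₀ (∀̇ ((var fz ≤̇ wkT t) ⇒̇ φ))
  bex   : ∀ (t : Term n) {φ} → IsΔ₀ φ → IsΔ₀ (∃̇ ((var fz ≤̇ wkT t) ∧̇ φ))

data IsΣ : {n : ℕ} → ℕ → Formula n → Set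
data IsΠ : {n : ℕ} → ℕ → Formula n → Set

data IsΣ where
  Δ₀Σ  : ∀ {n} {φ : Formula n} → IsΔ₀ φ → IsΣ 0 φ
  ΠΣ   : ∀ {n k} {φ : Formula n} → IsΠ k φ → IsΣ (suc k) φ
  ∃Σ   : ∀ {n k} {φ : Formula (suc n)} → IsΣ (suc k) φ → IsΣ (suc k) (∃̇ φ)

data IsΠ where
  Δ₀Π  : ∀ {n} {φ : Formula n} → IsΔ₀ φ → IsΠ 0 φ
  ΣΠ   : ∀ {n k} {φ : Formula n} → IsΣ k φ → IsΠ (suc k) φ
  ∀Π   : ∀ {n k} {φ : Formula (suc n)} → IsΠ (suc k) φ → IsΠ (suc k) (∀̇ φ)

_∷ₑ_ : ∀ {n} → ℕ → (Fin n → ℕ) → Fin (suc n) → ℕ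
(a ∷ₑ ρ) fz     = a
(a ∷ₑ ρ) (fs i) = ρ i

⟦_⟧t : ∀ {n} → Term n → (Fin n → ℕ) → ℕ
⟦ var i ⟧t  ρ = ρ i
⟦ zer ⟧t    ρ = 0
⟦ S t ⟧t    ρ = suc (⟦ t ⟧t ρ)
⟦ s +' t ⟧t ρ = ⟦ s ⟧t ρ + ⟦ t ⟧t ρ
⟦ s *' t ⟧t ρ = ⟦ s ⟧t ρ * ⟦ t ⟧t ρ

⟦_⟧ : ∀ {n} → Formula n → (Fin n → ℕ) → Set
⟦ s ≐ t ⟧ ρ = ⟦ s ⟧t ρ ≡ ⟦ t ⟧t ρ
⟦ ⊥̇ ⟧     ρ = ⊥
⟦ φ ⇒̇ ψ ⟧ ρ = ⟦ φ ⟧ ρ → ⟦ ψ ⟧ ρ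
⟦ φ ∧̇ ψ ⟧ ρ = ⟦ φ ⟧ ρ × ⟦ ψ ⟧ ρ
⟦ φ ∨̇ ψ ⟧ ρ = ⟦ φ ⟧ ρ ⊎ ⟦ ψ ⟧ ρ
⟦ ∀̇ φ ⟧   ρ = (a : ℕ) → ⟦ φ ⟧ (a ∷ₑ ρ)
⟦ ∃̇ φ ⟧   ρ = Σ ℕ λ a → ⟦ φ ⟧ (a ∷ₑ ρ)

TrueInℕ : Sentence → Set
TrueInℕ σ = ⟦ σ ⟧ (λ ())

Theory : Set₁
Theory = Sentence → Set

data Deriv (T : Theory) : {n : ℕ} → List (Formula n) → Formula n → Set where
  ax    : ∀ {n} {Δ : List (Formula n)} {σ} → T σ → Deriv T Δ (close σ)
  hyp   : ∀ {n} {Δ : List (Formula n)} {φ} → φ ∈ Δ → Deriv T Δ φ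
  ⇒I    : ∀ {n} {Δ : List (Formula n)} {φ ψ} → Deriv T (φ ∷ Δ) ψ → Deriv T Δ (φ ⇒̇ ψ)
  ⇒E    : ∀ {n} {Δ : List (Formula n)} {φ ψ} → Deriv T Δ (φ ⇒̇ ψ) → Deriv T Δ φ → Deriv T Δ ψ
  ∧I    : ∀ {n} {Δ : List (Formula n)} {φ ψ} → Deriv T Δ φ → Deriv T Δ ψ → Deriv T Δ (φ ∧̇ ψ)
  ∧E₁   : ∀ {n} {Δ : List (Formula n)} {φ ψ} → Deriv T Δ (φ ∧̇ ψ) → Deriv T Δ φ
  ∧E₂   : ∀ {n} {Δ : List (Formula n)} {φ ψ} → Deriv T Δ (φ ∧̇ ψ) → Deriv T Δ ψ
  ∨I₁   : ∀ {n} {Δ : List (Formula n)} {φ ψ} → Deriv T Δ φ → Deriv T Δ (φ ∨̇ ψ)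
  ∨I₂   : ∀ {n} {Δ : List (Formula n)} {φ ψ} → Deriv T Δ ψ → Deriv T Δ (φ ∨̇ ψ)
  ∨E    : ∀ {n} {Δ : List (Formula n)} {φ ψ χ} → Deriv T Δ (φ ∨̇ ψ) →
          Deriv T (φ ∷ Δ) χ → Deriv T (ψ ∷ Δ) χ → Deriv T Δ χ
  ⊥E    : ∀ {n} {Δ : List (Formula n)} {φ} → Deriv T Δ ⊥̇ → Deriv T Δ φ
  raa   : ∀ {n} {Δ : List (Formula n)} {φ} → Deriv T ((¬̇ φ) ∷ Δ) ⊥̇ → Deriv T Δ φ
  ∀I    : ∀ {n} {Δ : List (Formula n)} {φ} → Deriv T (map wk Δ) φ → Deriv T Δ (∀̇ φ)
  ∀E    : ∀ {n} {Δ : List (Formula n)} {φ} → Deriv T Δ (∀̇ φ) → (t : Term n) → Deriv T Δ (φ [ t ])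
  ∃I    : ∀ {n} {Δ : List (Formula n)} {φ} (t : Term n) → Deriv T Δ (φ [ t ]) → Deriv T Δ (∃̇ φ)
  ∃E    : ∀ {n} {Δ : List (Formula n)} {φ ψ} → Deriv T Δ (∃̇ φ) →
          Deriv T (φ ∷ map wk Δ) (wk ψ) → Deriv T Δ ψ
  ≐refl : ∀ {n} {Δ : List (Formula n)} (t : Term n) → Deriv T Δ (t ≐ t)
  ≐subst : ∀ {n} {Δ : List (Formula n)} {s t} (φ : Formula (suc n)) →
          Deriv T Δ (s ≐ t) → Deriv T Δ (φ [ s ]) → Deriv T Δ (φ [ t ])

infix 2 _⊢_
_⊢_ : Theory → Sentence → Set
T ⊢ σ = Deriv T [] σ

x₀ x₁ : ∀ {n} → Term (suc (suc n))
x₀ = var fz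
x₁ = var (fs fz)

data QAxiom : Sentence → Set where
  Q1 : QAxiom (∀̇ (¬̇ (S (var fz) ≐ zer)))
  Q2 : QAxiom (∀̇ (∀̇ (S x₁ ≐ S x₀ ⇒̇ x₁ ≐ x₀)))
  Q3 : QAxiom (∀̇ (var fz ≐ zer ∨̇ ∃̇ (x₁ ≐ S x₀)))
  Q4 : QAxiom (∀̇ (var fz +' zer ≐ var fz))
  Q5 : QAxiom (∀̇ (∀̇ (x₁ +' S x₀ ≐ S (x₁ +' x₀))))
  Q6 : QAxiom (∀̇ (var fz *' zer ≐ zer))
  Q7 : QAxiom (∀̇ (∀̇ (x₁ *' S x₀ ≐ (x₁ *' x₀) +' x₁)))

ExtendsQ : Theory → Set
ExtendsQ T = ∀ σ → QAxiom σ → T ⊢ σ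

ωConsistent : Theory → Set
ωConsistent T = ¬ (Σ (Formula 1) λ ξ →
  (T ⊢ ∃̇ (¬̇ ξ)) × ((n : ℕ) → T ⊢ ξ [ num n ]))

tri : ℕ → ℕ
tri zero    = zero
tri (suc k) = suc k + tri k

pair : ℕ → ℕ → ℕ
pair a b = tri (a + b) + b

⌜_⌝t : ∀ {n} → Term n → ℕ
⌜ var i ⌝t  = pair 0 (toℕ i)
⌜ zer ⌝t    = pair 1 0
⌜ S t ⌝t    = pair 2 ⌜ t ⌝t
⌜ s +' t ⌝t = pair 3 (pair ⌜ s ⌝t ⌜ t ⌝t)
⌜ s *' t ⌝t = pair 4 (pair ⌜ s ⌝t ⌜ t ⌝t)

⌜_⌝ : ∀ {n} → Formula n → ℕ
⌜ s ≐ t ⌝ = pair 0 (pair ⌜ s ⌝t ⌜ t ⌝t)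
⌜ ⊥̇ ⌝     = pair 1 0
⌜ φ ⇒̇ ψ ⌝ = pair 2 (pair ⌜ φ ⌝ ⌜ ψ ⌝)
⌜ φ ∧̇ ψ ⌝ = pair 3 (pair ⌜ φ ⌝ ⌜ ψ ⌝)
⌜ φ ∨̇ ψ ⌝ = pair 4 (pair ⌜ φ ⌝ ⌜ ψ ⌝)
⌜ ∀̇ φ ⌝   = pair 5 ⌜ φ ⌝
⌜ ∃̇ φ ⌝   = pair 6 ⌜ φ ⌝

#_ : ∀ {n} → Sentence → Term n
# σ = num ⌜ σ ⌝

RecursivelyEnumerable : Theory → Set
RecursivelyEnumerable T = Σ (Formula 1) λ θ → IsΣ 1 θ ×
  ((σ : Sentence) → (T σ → TrueInℕ (θ [ # σ ])) × (TrueInℕ (θ [ # σ ]) → T σ))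

IsProvabilityPredicate : Theory → Formula 1 → Set
IsProvabilityPredicate T Pr = IsΣ 1 Pr ×
  ((σ : Sentence) → ((T ⊢ σ) → TrueInℕ (Pr [ # σ ])) × (TrueInℕ (Pr [ # σ ]) → T ⊢ σ))

Gödelian : Theory → Formula 1 → Sentence → Set
Gödelian T Pr G = T ⊢ (G ⇔̇ ¬̇ (Pr [ # G ]))

{-# OPTIONS --safe #-}
-- Classically, Q proves every true Δ₀ instance and refutes every false one, since it evaluates
-- closed terms and splits bounded quantifiers into finitely many numeral cases; hence it also
-- refutes every false Π₁ instance. A false Σ₂ sentence ∃ȳ ψ(ȳ), ψ ∈ Π₁, is then ω-refuted: coding
-- the tuple ȳ by one number k through additive splittings k = y₁ + (y₂ + …), T proves
-- "k codes no witness" for every numeral k, while the sentence implies that some k does. So an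
-- ω-consistent T proves no false Σ₂ sentence, and instantiating the universal block of a provable
-- Π₃ sentence with numerals shows it is true. For a Gödelian Π₃ sentence G, if G were false then
-- so would be Pr(#G) (otherwise T ⊢ G, and G is true by the first part); being a false Σ₁ sentence,
-- Pr(#G) is ω-refuted, and T ⊢ G ∨ Pr(#G) makes G true after all.

module Submission where

open import Defs
open import Level using (0ℓ)
open import Axiom.ExcludedMiddle using (ExcludedMiddle)
open import Axiom.DoubleNegationElimination using (em⇒dne)
open import Function using (_∘_; _⇔_; mk⇔; Equivalence)
open import Function.Related.TypeIsomorphisms using (→-cong-⇔)
open import Data.Product using (∃; _×_; _,_; proj₂)
open import Data.Product.Function.NonDependent.Propositional using (_×-⇔_)
open import Data.Sum using (inj₁; inj₂)
open import Data.Sum.Function.Propositional using (_⊎-⇔_)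
open import Data.Nat using (ℕ; zero; suc; _+_; _*_; _≤_)
open import Data.Nat.Properties
  using (+-identityʳ; +-suc; *-suc; *-zeroʳ; +-comm; m≤n+m; m≤n⇒∃[o]m+o≡n)
open import Data.Fin using (Fin) renaming (zero to fz; suc to fs)
open import Data.List using (List; []; _∷_; map)
open import Data.List.Membership.Propositional using (_∈_)
open import Data.List.Membership.Propositional.Properties using (∈-map⁺; ∈-map⁻)
open import Data.List.Relation.Unary.Any using (here; there)
open import Data.Empty using (⊥-elim)
open import Relation.Nullary using (¬_; yes; no)
open import Relation.Binary.PropositionalEquality
  using (_≡_; _≗_; refl; sym; trans; cong; cong₂; subst)

open Equivalence using (to; from)

infixr 5 _∷ₜ_

_∷ₜ_ : ∀ {m n} → Term n → (Fin m → Term n) → Fin (suc m) → Term n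
(t ∷ₜ σ) fz     = t
(t ∷ₜ σ) (fs i) = σ i

module _ {m n : ℕ} where

  subT-cong : {σ τ : Fin m → Term n} → σ ≗ τ → subT σ ≗ subT τ
  subT-cong h (var i)  = h i
  subT-cong h zer      = refl
  subT-cong h (S t)    = cong S (subT-cong h t)
  subT-cong h (s +' t) = cong₂ _+'_ (subT-cong h s) (subT-cong h t)
  subT-cong h (s *' t) = cong₂ _*'_ (subT-cong h s) (subT-cong h t)

  exts-cong : {σ τ : Fin m → Term n} → σ ≗ τ → exts σ ≗ exts τ
  exts-cong h fz     = refl
  exts-cong h (fs i) = cong wkT (h i)

subF-cong : ∀ {m n} {σ τ : Fin m → Term n} → σ ≗ τ → subF σ ≗ subF τ
subF-cong h (s ≐ t)  = cong₂ _≐_ (subT-cong h s) (subT-cong h t)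
subF-cong h ⊥̇        = refl
subF-cong h (φ ⇒̇ ψ)  = cong₂ _⇒̇_ (subF-cong h φ) (subF-cong h ψ)
subF-cong h (φ ∧̇ ψ)  = cong₂ _∧̇_ (subF-cong h φ) (subF-cong h ψ)
subF-cong h (φ ∨̇ ψ)  = cong₂ _∨̇_ (subF-cong h φ) (subF-cong h ψ)
subF-cong h (∀̇ φ)    = cong ∀̇ (subF-cong (exts-cong h) φ)
subF-cong h (∃̇ φ)    = cong ∃̇ (subF-cong (exts-cong h) φ)

renT-as-subT : ∀ {m n} (ρ : Fin m → Fin n) → renT ρ ≗ subT (var ∘ ρ)
renT-as-subT ρ (var i)  = refl
renT-as-subT ρ zer      = refl
renT-as-subT ρ (S t)    = cong S (renT-as-subT ρ t)
renT-as-subT ρ (s +' t) = cong₂ _+'_ (renT-as-subT ρ s) (renT-as-subT ρ t)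
renT-as-subT ρ (s *' t) = cong₂ _*'_ (renT-as-subT ρ s) (renT-as-subT ρ t)

ext-as-exts : ∀ {m n} (ρ : Fin m → Fin n) → var ∘ ext ρ ≗ exts (var ∘ ρ)
ext-as-exts ρ fz     = refl
ext-as-exts ρ (fs i) = refl

renF-as-subF : ∀ {m n} (ρ : Fin m → Fin n) → renF ρ ≗ subF (var ∘ ρ)
renF-as-subF ρ (s ≐ t) = cong₂ _≐_ (renT-as-subT ρ s) (renT-as-subT ρ t)
renF-as-subF ρ ⊥̇       = refl
renF-as-subF ρ (φ ⇒̇ ψ) = cong₂ _⇒̇_ (renF-as-subF ρ φ) (renF-as-subF ρ ψ)
renF-as-subF ρ (φ ∧̇ ψ) = cong₂ _∧̇_ (renF-as-subF ρ φ) (renF-as-subF ρ ψ)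
renF-as-subF ρ (φ ∨̇ ψ) = cong₂ _∨̇_ (renF-as-subF ρ φ) (renF-as-subF ρ ψ)
renF-as-subF ρ (∀̇ φ)   = cong ∀̇ (trans (renF-as-subF (ext ρ) φ) (subF-cong (ext-as-exts ρ) φ))
renF-as-subF ρ (∃̇ φ)   = cong ∃̇ (trans (renF-as-subF (ext ρ) φ) (subF-cong (ext-as-exts ρ) φ))

subT-exts-wkT : ∀ {m n} (σ : Fin m → Term n) t → subT (exts σ) (wkT t) ≡ wkT (subT σ t)
subT-exts-wkT σ (var i)  = refl
subT-exts-wkT σ zer      = refl
subT-exts-wkT σ (S t)    = cong S (subT-exts-wkT σ t)
subT-exts-wkT σ (s +' t) = cong₂ _+'_ (subT-exts-wkT σ s) (subT-exts-wkT σ t)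
subT-exts-wkT σ (s *' t) = cong₂ _*'_ (subT-exts-wkT σ s) (subT-exts-wkT σ t)

subT-subT : ∀ {k m n} (σ : Fin m → Term n) (τ : Fin k → Term m) →
            subT σ ∘ subT τ ≗ subT (subT σ ∘ τ)
subT-subT σ τ (var i)  = refl
subT-subT σ τ zer      = refl
subT-subT σ τ (S t)    = cong S (subT-subT σ τ t)
subT-subT σ τ (s +' t) = cong₂ _+'_ (subT-subT σ τ s) (subT-subT σ τ t)
subT-subT σ τ (s *' t) = cong₂ _*'_ (subT-subT σ τ s) (subT-subT σ τ t)

subT-exts : ∀ {k m n} (σ : Fin m → Term n) (τ : Fin k → Term m) →
            subT (exts σ) ∘ exts τ ≗ exts (subT σ ∘ τ)
subT-exts σ τ fz     = refl
subT-exts σ τ (fs i) = subT-exts-wkT σ (τ i)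

subF-subF : ∀ {k m n} (σ : Fin m → Term n) (τ : Fin k → Term m) →
            subF σ ∘ subF τ ≗ subF (subT σ ∘ τ)
subF-subF σ τ (s ≐ t) = cong₂ _≐_ (subT-subT σ τ s) (subT-subT σ τ t)
subF-subF σ τ ⊥̇       = refl
subF-subF σ τ (φ ⇒̇ ψ) = cong₂ _⇒̇_ (subF-subF σ τ φ) (subF-subF σ τ ψ)
subF-subF σ τ (φ ∧̇ ψ) = cong₂ _∧̇_ (subF-subF σ τ φ) (subF-subF σ τ ψ)
subF-subF σ τ (φ ∨̇ ψ) = cong₂ _∨̇_ (subF-subF σ τ φ) (subF-subF σ τ ψ)
subF-subF σ τ (∀̇ φ)   = cong ∀̇ (trans (subF-subF (exts σ) (exts τ) φ) (subF-cong (subT-exts σ τ) φ))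
subF-subF σ τ (∃̇ φ)   = cong ∃̇ (trans (subF-subF (exts σ) (exts τ) φ) (subF-cong (subT-exts σ τ) φ))

subT-var : ∀ {n} {σ : Fin n → Term n} → σ ≗ var → subT σ ≗ (λ t → t)
subT-var h (var i)  = h i
subT-var h zer      = refl
subT-var h (S t)    = cong S (subT-var h t)
subT-var h (s +' t) = cong₂ _+'_ (subT-var h s) (subT-var h t)
subT-var h (s *' t) = cong₂ _*'_ (subT-var h s) (subT-var h t)

exts-var : ∀ {n} {σ : Fin n → Term n} → σ ≗ var → exts σ ≗ var
exts-var h fz     = refl
exts-var h (fs i) = cong wkT (h i)

subF-var : ∀ {n} {σ : Fin n → Term n} → σ ≗ var → subF σ ≗ (λ φ → φ)
subF-var h (s ≐ t) = cong₂ _≐_ (subT-var h s) (subT-var h t)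
subF-var h ⊥̇       = refl
subF-var h (φ ⇒̇ ψ) = cong₂ _⇒̇_ (subF-var h φ) (subF-var h ψ)
subF-var h (φ ∧̇ ψ) = cong₂ _∧̇_ (subF-var h φ) (subF-var h ψ)
subF-var h (φ ∨̇ ψ) = cong₂ _∨̇_ (subF-var h φ) (subF-var h ψ)
subF-var h (∀̇ φ)   = cong ∀̇ (subF-var (exts-var h) φ)
subF-var h (∃̇ φ)   = cong ∃̇ (subF-var (exts-var h) φ)

subF-fuse : ∀ {k m n} {σ : Fin m → Term n} {τ : Fin k → Term m} {υ : Fin k → Term n} φ →
            subT σ ∘ τ ≗ υ → subF σ (subF τ φ) ≡ subF υ φ
subF-fuse {σ = σ} {τ} φ h = trans (subF-subF σ τ φ) (subF-cong h φ)

subF-renF-fuse : ∀ {k m n} {σ : Fin m → Term n} {ρ : Fin k → Fin m} {υ : Fin k → Term n} φ →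
                 σ ∘ ρ ≗ υ → subF σ (renF ρ φ) ≡ subF υ φ
subF-renF-fuse {σ = σ} {ρ} φ h = trans (cong (subF σ) (renF-as-subF ρ φ)) (subF-fuse φ h)

renF-≗-subF : ∀ {m n} {ρ : Fin m → Fin n} {υ : Fin m → Term n} φ →
              var ∘ ρ ≗ υ → renF ρ φ ≡ subF υ φ
renF-≗-subF {ρ = ρ} φ h = trans (renF-as-subF ρ φ) (subF-cong h φ)

subT-sub0-wkT : ∀ {n} (u t : Term n) → subT (sub0 u) (wkT t) ≡ t
subT-sub0-wkT u t =
  trans (cong (subT (sub0 u)) (renT-as-subT fs t)) (trans (subT-subT (sub0 u) _ t) (subT-var (λ _ → refl) t))

subF-sub0-wk : ∀ {n} (u : Term n) φ → subF (sub0 u) (wk φ) ≡ φ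
subF-sub0-wk u φ = trans (subF-renF-fuse φ (λ _ → refl)) (subF-var (λ _ → refl) φ)

subF-exts-wk : ∀ {m n} (σ : Fin m → Term n) φ → subF (exts σ) (wk φ) ≡ wk (subF σ φ)
subF-exts-wk σ φ = trans (subF-renF-fuse φ (λ _ → refl))
  (sym (trans (renF-as-subF fs (subF σ φ)) (subF-fuse φ (λ i → sym (renT-as-subT fs (σ i))))))

subF-[] : ∀ {m n} (σ : Fin m → Term n) φ t → subF σ (φ [ t ]) ≡ subF (exts σ) φ [ subT σ t ]
subF-[] σ φ t = trans (subF-fuse φ (λ _ → refl))
  (sym (subF-fuse φ λ { fz → refl ; (fs i) → subT-sub0-wkT (subT σ t) (σ i) }))

close-as-subF : ∀ {n} (σ : Fin 0 → Term n) φ → close φ ≡ subF σ φ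
close-as-subF σ φ = renF-≗-subF φ (λ ())

subT-num : ∀ {m n} (σ : Fin m → Term n) k → subT σ (num k) ≡ num k
subT-num σ zero    = refl
subT-num σ (suc k) = cong S (subT-num σ k)

renT-num : ∀ {m n} (ρ : Fin m → Fin n) k → renT ρ (num k) ≡ num k
renT-num ρ zero    = refl
renT-num ρ (suc k) = cong S (renT-num ρ k)

subF-≤̇ : ∀ {m n} (σ : Fin m → Term n) s u → subF σ (s ≤̇ u) ≡ (subT σ s ≤̇ subT σ u)
subF-≤̇ σ s u = cong ∃̇ (cong₂ (λ a b → var fz +' a ≐ b) (subT-exts-wkT σ s) (subT-exts-wkT σ u))

subF-exts-≤̇ : ∀ {m n} (σ : Fin m → Term n) t →
              subF (exts σ) (var fz ≤̇ wkT t) ≡ (var fz ≤̇ wkT (subT σ t))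
subF-exts-≤̇ σ t = trans (subF-≤̇ (exts σ) (var fz) (wkT t)) (cong (var fz ≤̇_) (subT-exts-wkT σ t))

numerals : ∀ {n} → (Fin n → ℕ) → Fin n → Term 0
numerals ρ i = num (ρ i)

inst : ∀ {n} → (Fin n → ℕ) → Formula n → Sentence
inst ρ = subF (numerals ρ)

inst-∷ₑ : ∀ {n} (ψ : Formula (suc n)) a (ρ : Fin n → ℕ) →
          subF (exts (numerals ρ)) ψ [ num a ] ≡ inst (a ∷ₑ ρ) ψ
inst-∷ₑ ψ a ρ = subF-fuse ψ λ { fz → refl ; (fs i) → subT-sub0-wkT (num a) (num (ρ i)) }

inst-∀≤ : ∀ {n} (ρ : Fin n → ℕ) t ψ →
          inst ρ (∀̇ ((var fz ≤̇ wkT t) ⇒̇ ψ))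
          ≡ ∀̇ ((var fz ≤̇ wkT (subT (numerals ρ) t)) ⇒̇ subF (exts (numerals ρ)) ψ)
inst-∀≤ ρ t ψ = cong (λ A → ∀̇ (A ⇒̇ subF (exts (numerals ρ)) ψ)) (subF-exts-≤̇ (numerals ρ) t)

inst-∃≤ : ∀ {n} (ρ : Fin n → ℕ) t ψ →
          inst ρ (∃̇ ((var fz ≤̇ wkT t) ∧̇ ψ))
          ≡ ∃̇ ((var fz ≤̇ wkT (subT (numerals ρ) t)) ∧̇ subF (exts (numerals ρ)) ψ)
inst-∃≤ ρ t ψ = cong (λ A → ∃̇ (A ∧̇ subF (exts (numerals ρ)) ψ)) (subF-exts-≤̇ (numerals ρ) t)

emptyₑ : Fin 0 → ℕ
emptyₑ ()

⟦renT⟧ : ∀ {m n} (ρ : Fin m → Fin n) {e : Fin n → ℕ} {e' : Fin m → ℕ} →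
         e ∘ ρ ≗ e' → ∀ t → ⟦ renT ρ t ⟧t e ≡ ⟦ t ⟧t e'
⟦renT⟧ ρ h (var i)  = h i
⟦renT⟧ ρ h zer      = refl
⟦renT⟧ ρ h (S t)    = cong suc (⟦renT⟧ ρ h t)
⟦renT⟧ ρ h (s +' t) = cong₂ _+_ (⟦renT⟧ ρ h s) (⟦renT⟧ ρ h t)
⟦renT⟧ ρ h (s *' t) = cong₂ _*_ (⟦renT⟧ ρ h s) (⟦renT⟧ ρ h t)

⟦wkT⟧ : ∀ {n} (t : Term n) a (e : Fin n → ℕ) → ⟦ wkT t ⟧t (a ∷ₑ e) ≡ ⟦ t ⟧t e
⟦wkT⟧ t a e = ⟦renT⟧ fs (λ _ → refl) t

module _ {m n} (σ : Fin m → Term n) {e : Fin n → ℕ} {e' : Fin m → ℕ} where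

  ⟦subT⟧ : (λ i → ⟦ σ i ⟧t e) ≗ e' → ∀ t → ⟦ subT σ t ⟧t e ≡ ⟦ t ⟧t e'
  ⟦subT⟧ h (var i)  = h i
  ⟦subT⟧ h zer      = refl
  ⟦subT⟧ h (S t)    = cong suc (⟦subT⟧ h t)
  ⟦subT⟧ h (s +' t) = cong₂ _+_ (⟦subT⟧ h s) (⟦subT⟧ h t)
  ⟦subT⟧ h (s *' t) = cong₂ _*_ (⟦subT⟧ h s) (⟦subT⟧ h t)

  ⟦exts⟧ : (λ i → ⟦ σ i ⟧t e) ≗ e' → ∀ a → (λ i → ⟦ exts σ i ⟧t (a ∷ₑ e)) ≗ (a ∷ₑ e')
  ⟦exts⟧ h a fz     = refl
  ⟦exts⟧ h a (fs i) = trans (⟦wkT⟧ (σ i) a e) (h i)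

⟦subF⟧ : ∀ {m n} φ (σ : Fin m → Term n) {e : Fin n → ℕ} {e' : Fin m → ℕ} →
         (λ i → ⟦ σ i ⟧t e) ≗ e' → ⟦ subF σ φ ⟧ e ⇔ ⟦ φ ⟧ e'
⟦subF⟧ (s ≐ t) σ h = mk⇔
  (λ p → trans (sym (⟦subT⟧ σ h s)) (trans p (⟦subT⟧ σ h t)))
  (λ p → trans (⟦subT⟧ σ h s) (trans p (sym (⟦subT⟧ σ h t))))
⟦subF⟧ ⊥̇       σ h = mk⇔ (λ x → x) (λ x → x)
⟦subF⟧ (φ ⇒̇ ψ) σ h = →-cong-⇔ (⟦subF⟧ φ σ h) (⟦subF⟧ ψ σ h)
⟦subF⟧ (φ ∧̇ ψ) σ h = ⟦subF⟧ φ σ h ×-⇔ ⟦subF⟧ ψ σ h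
⟦subF⟧ (φ ∨̇ ψ) σ h = ⟦subF⟧ φ σ h ⊎-⇔ ⟦subF⟧ ψ σ h
⟦subF⟧ (∀̇ φ)   σ h = mk⇔
  (λ f a → to (⟦subF⟧ φ (exts σ) (⟦exts⟧ σ h a)) (f a))
  (λ f a → from (⟦subF⟧ φ (exts σ) (⟦exts⟧ σ h a)) (f a))
⟦subF⟧ (∃̇ φ)   σ h = mk⇔
  (λ (a , x) → a , to (⟦subF⟧ φ (exts σ) (⟦exts⟧ σ h a)) x)
  (λ (a , x) → a , from (⟦subF⟧ φ (exts σ) (⟦exts⟧ σ h a)) x)

⟦num⟧ : ∀ {n} (e : Fin n → ℕ) k → ⟦ num k ⟧t e ≡ k
⟦num⟧ e zero    = refl
⟦num⟧ e (suc k) = cong suc (⟦num⟧ e k)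

⟦⟧-cong : ∀ {n} φ {e e' : Fin n → ℕ} → e ≗ e' → ⟦ φ ⟧ e → ⟦ φ ⟧ e'
⟦⟧-cong φ {e} h x = to (⟦subF⟧ φ var h) (subst (λ ψ → ⟦ ψ ⟧ e) (sym (subF-var (λ _ → refl) φ)) x)

value : Term 0 → ℕ
value t = ⟦ t ⟧t emptyₑ

value-inst : ∀ {n} t (ρ : Fin n → ℕ) → value (subT (numerals ρ) t) ≡ ⟦ t ⟧t ρ
value-inst t ρ = ⟦subT⟧ (numerals ρ) (λ i → ⟦num⟧ emptyₑ (ρ i)) t

⟦≤̇⟧ : ∀ {n} (t : Term n) a (ρ : Fin n → ℕ) →
      ⟦ var fz ≤̇ wkT t ⟧ (a ∷ₑ ρ) ⇔ a ≤ value (subT (numerals ρ) t)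
⟦≤̇⟧ t a ρ = mk⇔
  (λ (c , p) → subst (a ≤_) (trans p (wk²-value c)) (m≤n+m a c))
  (λ a≤ → let (c , p) = m≤n⇒∃[o]m+o≡n a≤ in c , trans (+-comm c a) (trans p (sym (wk²-value c))))
  where
  wk²-value : ∀ c → ⟦ wkT (wkT t) ⟧t (c ∷ₑ (a ∷ₑ ρ)) ≡ value (subT (numerals ρ) t)
  wk²-value c = trans (⟦wkT⟧ (wkT t) c (a ∷ₑ ρ)) (trans (⟦wkT⟧ t a ρ) (sym (value-inst t ρ)))

module Derivations (T : Theory) where

  cast : ∀ {n} {Δ : List (Formula n)} {A B} → A ≡ B → Deriv T Δ A → Deriv T Δ B
  cast refl d = d

  cast-num : ∀ {n} {Δ : List (Formula n)} {s a b} → a ≡ b → Deriv T Δ (s ≐ num a) → Deriv T Δ (s ≐ num b)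
  cast-num refl d = d

  module _ {m n} (σ : Fin m → Term n) {Δ : List (Formula m)} {Γ : List (Formula n)}
           (h : ∀ {ψ} → ψ ∈ Δ → subF σ ψ ∈ Γ) where

    subF-∈-∷ : ∀ {φ ψ} → ψ ∈ φ ∷ Δ → subF σ ψ ∈ subF σ φ ∷ Γ
    subF-∈-∷ (here refl) = here refl
    subF-∈-∷ (there p)   = there (h p)

    subF-∈-map-wk : ∀ {ψ} → ψ ∈ map wk Δ → subF (exts σ) ψ ∈ map wk Γ
    subF-∈-map-wk p with ∈-map⁻ wk p
    ... | χ , q , refl = subst (_∈ map wk Γ) (sym (subF-exts-wk σ χ)) (∈-map⁺ wk (h q))

  Deriv-subF : ∀ {m n} {Δ : List (Formula m)} {Γ : List (Formula n)} {φ} (σ : Fin m → Term n) →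
               (∀ {ψ} → ψ ∈ Δ → subF σ ψ ∈ Γ) → Deriv T Δ φ → Deriv T Γ (subF σ φ)
  Deriv-subF σ h (ax {σ = s} x) =
    cast (trans (close-as-subF (λ ()) s) (sym (subF-renF-fuse s (λ ())))) (ax x)
  Deriv-subF σ h (hyp p)     = hyp (h p)
  Deriv-subF σ h (⇒I d)      = ⇒I (Deriv-subF σ (subF-∈-∷ σ h) d)
  Deriv-subF σ h (⇒E d e)    = ⇒E (Deriv-subF σ h d) (Deriv-subF σ h e)
  Deriv-subF σ h (∧I d e)    = ∧I (Deriv-subF σ h d) (Deriv-subF σ h e)
  Deriv-subF σ h (∧E₁ d)     = ∧E₁ (Deriv-subF σ h d)
  Deriv-subF σ h (∧E₂ d)     = ∧E₂ (Deriv-subF σ h d)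
  Deriv-subF σ h (∨I₁ d)     = ∨I₁ (Deriv-subF σ h d)
  Deriv-subF σ h (∨I₂ d)     = ∨I₂ (Deriv-subF σ h d)
  Deriv-subF σ h (∨E d e f)  =
    ∨E (Deriv-subF σ h d) (Deriv-subF σ (subF-∈-∷ σ h) e) (Deriv-subF σ (subF-∈-∷ σ h) f)
  Deriv-subF σ h (⊥E d)      = ⊥E (Deriv-subF σ h d)
  Deriv-subF σ h (raa d)     = raa (Deriv-subF σ (subF-∈-∷ σ h) d)
  Deriv-subF σ h (∀I d)      = ∀I (Deriv-subF (exts σ) (subF-∈-map-wk σ h) d)
  Deriv-subF σ h (∀E {φ = φ} d t) = cast (sym (subF-[] σ φ t)) (∀E (Deriv-subF σ h d) (subT σ t))
  Deriv-subF σ h (∃I {φ = φ} t d) = ∃I (subT σ t) (cast (subF-[] σ φ t) (Deriv-subF σ h d))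
  Deriv-subF σ h (∃E {ψ = ψ} d e) =
    ∃E (Deriv-subF σ h d)
       (cast (subF-exts-wk σ ψ) (Deriv-subF (exts σ) (subF-∈-∷ (exts σ) (subF-∈-map-wk σ h)) e))
  Deriv-subF σ h (≐refl t)   = ≐refl (subT σ t)
  Deriv-subF σ h (≐subst {s = s} {t = t} φ d e) =
    cast (sym (subF-[] σ φ t))
         (≐subst (subF (exts σ) φ) (Deriv-subF σ h d) (cast (subF-[] σ φ s) (Deriv-subF σ h e)))

  weaken : ∀ {n} {Δ Γ : List (Formula n)} {φ} → (∀ {ψ} → ψ ∈ Δ → ψ ∈ Γ) → Deriv T Δ φ → Deriv T Γ φ
  weaken {Γ = Γ} {φ} h d = cast (subF-var (λ _ → refl) φ)
    (Deriv-subF var (λ {ψ} p → subst (_∈ Γ) (sym (subF-var (λ _ → refl) ψ)) (h p)) d)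

  weaken₀ : ∀ {Δ : List Sentence} {φ} → T ⊢ φ → Deriv T Δ φ
  weaken₀ = weaken (λ ())

  Deriv-wk : ∀ {n} {Δ : List (Formula n)} {φ} → Deriv T Δ φ → Deriv T (map wk Δ) (wk φ)
  Deriv-wk {Δ = Δ} {φ} d = cast (sym (renF-as-subF fs φ))
    (Deriv-subF (var ∘ fs) (λ {ψ} p → subst (_∈ map wk Δ) (renF-as-subF fs ψ) (∈-map⁺ wk p)) d)

  ⊢-lift : ∀ {n} {Δ : List (Formula n)} {A} (σ : Fin 0 → Term n) → T ⊢ A → Deriv T Δ (subF σ A)
  ⊢-lift σ = Deriv-subF σ (λ ())

  ⇔¬⇒∨ : ∀ {G P} → T ⊢ (G ⇔̇ ¬̇ P) → T ⊢ (G ∨̇ P)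
  ⇔¬⇒∨ g = raa (⇒E (hyp (here refl))
    (∨I₁ (⇒E (∧E₂ (weaken₀ g)) (⇒I (⇒E (hyp (there (here refl))) (∨I₂ (hyp (here refl))))))))

  ≐-sym : ∀ {n} {Δ : List (Formula n)} {s t} → Deriv T Δ (s ≐ t) → Deriv T Δ (t ≐ s)
  ≐-sym {s = s} {t} e = cast (cong (t ≐_) (subT-sub0-wkT t s))
    (≐subst (var fz ≐ wkT s) e (cast (cong (s ≐_) (sym (subT-sub0-wkT s s))) (≐refl s)))

  ≐-trans : ∀ {n} {Δ : List (Formula n)} {s t u} → Deriv T Δ (s ≐ t) → Deriv T Δ (t ≐ u) → Deriv T Δ (s ≐ u)
  ≐-trans {s = s} {t} {u} e₁ e₂ = cast (cong (_≐ u) (subT-sub0-wkT u s))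
    (≐subst (wkT s ≐ var fz) e₂ (cast (cong (_≐ t) (sym (subT-sub0-wkT t s))) e₁))

  ≐-cong : ∀ {n} {Δ : List (Formula n)} {s t} (C : Term (suc n)) →
           Deriv T Δ (s ≐ t) → Deriv T Δ (subT (sub0 s) C ≐ subT (sub0 t) C)
  ≐-cong {s = s} {t} C e = cast (cong (_≐ _) (subT-sub0-wkT t _))
    (≐subst (wkT (subT (sub0 s) C) ≐ C) e
            (cast (cong (_≐ subT (sub0 s) C) (sym (subT-sub0-wkT s _))) (≐refl (subT (sub0 s) C))))

  ≐-congS : ∀ {n} {Δ : List (Formula n)} {s t} → Deriv T Δ (s ≐ t) → Deriv T Δ (S s ≐ S t)
  ≐-congS = ≐-cong (S (var fz))

  ≐-cong+ : ∀ {n} {Δ : List (Formula n)} {s t u v} →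
            Deriv T Δ (s ≐ t) → Deriv T Δ (u ≐ v) → Deriv T Δ (s +' u ≐ t +' v)
  ≐-cong+ {s = s} {t} {u} {v} e₁ e₂ = ≐-trans
    (cast (cong₂ (λ a b → s +' a ≐ t +' b) (subT-sub0-wkT s u) (subT-sub0-wkT t u))
          (≐-cong (var fz +' wkT u) e₁))
    (cast (cong₂ (λ a b → a +' u ≐ b +' v) (subT-sub0-wkT u t) (subT-sub0-wkT v t))
          (≐-cong (wkT t +' var fz) e₂))

  ≐-cong* : ∀ {n} {Δ : List (Formula n)} {s t u v} →
            Deriv T Δ (s ≐ t) → Deriv T Δ (u ≐ v) → Deriv T Δ (s *' u ≐ t *' v)
  ≐-cong* {s = s} {t} {u} {v} e₁ e₂ = ≐-trans
    (cast (cong₂ (λ a b → s *' a ≐ t *' b) (subT-sub0-wkT s u) (subT-sub0-wkT t u))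
          (≐-cong (var fz *' wkT u) e₁))
    (cast (cong₂ (λ a b → a *' u ≐ b *' v) (subT-sub0-wkT u t) (subT-sub0-wkT v t))
          (≐-cong (wkT t *' var fz) e₂))

  ≐-rewrite : ∀ {m n} {Δ : List (Formula n)} (χ : Formula (suc m)) (τ : Fin m → Term n) {a b} →
              Deriv T Δ (a ≐ b) → Deriv T Δ (subF (a ∷ₜ τ) χ) → Deriv T Δ (subF (b ∷ₜ τ) χ)
  ≐-rewrite χ τ {a} {b} e d = cast (at b) (≐subst (subF (var fz ∷ₜ wkT ∘ τ) χ) e (cast (sym (at a)) d))
    where
    at : ∀ c → subF (var fz ∷ₜ wkT ∘ τ) χ [ c ] ≡ subF (c ∷ₜ τ) χ
    at c = subF-fuse χ λ { fz → refl ; (fs i) → subT-sub0-wkT c (τ i) }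

  ≐num-instance : ∀ {Δ : List (Formula 1)} (ψ : Formula 1) {j} →
                  Deriv T Δ (var fz ≐ num j) → T ⊢ ψ [ num j ] → Deriv T Δ ψ
  ≐num-instance ψ {j} e d = cast (subF-var (λ { fz → refl ; (fs ()) }) ψ)
    (≐-rewrite ψ (λ ()) (≐-sym e)
               (cast (subF-fuse ψ λ { fz → subT-num (λ ()) j ; (fs ()) }) (⊢-lift (λ ()) d)))

  ≐num-instance₂ : ∀ {n} {Δ : List (Formula 2)} (χ : Formula (suc (suc n))) (ρ : Fin n → ℕ) {i j} →
                   Deriv T Δ (var (fs fz) ≐ num i) → Deriv T Δ (var fz ≐ num j) → T ⊢ inst (j ∷ₑ (i ∷ₑ ρ)) χ →
                   Deriv T Δ (subF (var fz ∷ₜ var (fs fz) ∷ₜ num ∘ ρ) χ)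
  ≐num-instance₂ χ ρ {i} {j} e₁ e₀ d =
    ≐-rewrite χ (var (fs fz) ∷ₜ num ∘ ρ) (≐-sym e₀)
      (cast (at (var (fs fz))) (≐-rewrite χ₁ (num ∘ ρ) (≐-sym e₁) (cast (sym (at (num i))) lifted)))
    where
    lifted : Deriv T _ (subF (num j ∷ₜ num i ∷ₜ num ∘ ρ) χ)
    lifted = cast (subF-fuse χ λ { fz → subT-num _ j ; (fs fz) → subT-num _ i
                                 ; (fs (fs l)) → subT-num _ (ρ l) })
                  (⊢-lift (λ ()) d)
    χ₁ : Formula (suc _)
    χ₁ = subF (num j ∷ₜ var fz ∷ₜ var ∘ fs) χ
    at : ∀ a → subF (a ∷ₜ num ∘ ρ) χ₁ ≡ subF (num j ∷ₜ a ∷ₜ num ∘ ρ) χ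
    at a = subF-fuse χ λ { fz → subT-num _ j ; (fs fz) → refl ; (fs (fs l)) → refl }

module Robinson {T : Theory} (T⊇Q : ExtendsQ T) where

  open Derivations T

  Q-axiom : ∀ {n} {Δ : List (Formula n)} {σ} → QAxiom σ → Deriv T Δ (close σ)
  Q-axiom {σ = σ} q = cast (sym (close-as-subF (λ ()) σ)) (⊢-lift (λ ()) (T⊇Q σ q))

  module _ {n} {Δ : List (Formula n)} where

    Q-S≢0 : ∀ t → Deriv T Δ (¬̇ (S t ≐ zer))
    Q-S≢0 = ∀E (Q-axiom Q1)

    Q-S-injective : ∀ {s t} → Deriv T Δ (S s ≐ S t) → Deriv T Δ (s ≐ t)
    Q-S-injective {s} {t} =
      ⇒E (cast (cong (λ a → S a ≐ S t ⇒̇ a ≐ t) (subT-sub0-wkT t s)) (∀E (∀E (Q-axiom Q2) s) t))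

    Q-zero-or-succ : ∀ t → Deriv T Δ (t ≐ zer ∨̇ ∃̇ (wkT t ≐ S (var fz)))
    Q-zero-or-succ = ∀E (Q-axiom Q3)

    Q-+0 : ∀ t → Deriv T Δ (t +' zer ≐ t)
    Q-+0 = ∀E (Q-axiom Q4)

    Q-+S : ∀ s t → Deriv T Δ (s +' S t ≐ S (s +' t))
    Q-+S s t = cast (cong (λ a → a +' S t ≐ S (a +' t)) (subT-sub0-wkT t s)) (∀E (∀E (Q-axiom Q5) s) t)

    Q-*0 : ∀ t → Deriv T Δ (t *' zer ≐ zer)
    Q-*0 = ∀E (Q-axiom Q6)

    Q-*S : ∀ s t → Deriv T Δ (s *' S t ≐ (s *' t) +' s)
    Q-*S s t = cast (cong (λ a → a *' S t ≐ (a *' t) +' a) (subT-sub0-wkT t s)) (∀E (∀E (Q-axiom Q7) s) t)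

    num-+ : ∀ a b → Deriv T Δ (num a +' num b ≐ num (a + b))
    num-+ a zero    = cast-num (sym (+-identityʳ a)) (Q-+0 (num a))
    num-+ a (suc b) = cast-num (sym (+-suc a b))
      (≐-trans (Q-+S (num a) (num b)) (≐-congS (num-+ a b)))

    num-* : ∀ a b → Deriv T Δ (num a *' num b ≐ num (a * b))
    num-* a zero    = cast-num (sym (*-zeroʳ a)) (Q-*0 (num a))
    num-* a (suc b) = cast-num (trans (+-comm (a * b) a) (sym (*-suc a b)))
      (≐-trans (Q-*S (num a) (num b)) (≐-trans (≐-cong+ (num-* a b) (≐refl (num a))) (num-+ (a * b) a)))

  num-≢ : ∀ {n} {Δ : List (Formula n)} a b → ¬ a ≡ b → Deriv T Δ (¬̇ (num a ≐ num b))
  num-≢ zero    zero    a≢b = ⊥-elim (a≢b refl)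
  num-≢ zero    (suc b) a≢b = ⇒I (⇒E (Q-S≢0 (num b)) (≐-sym (hyp (here refl))))
  num-≢ (suc a) zero    a≢b = Q-S≢0 (num a)
  num-≢ (suc a) (suc b) a≢b = ⇒I (⇒E (num-≢ a b (a≢b ∘ cong suc)) (Q-S-injective (hyp (here refl))))

  ⊢-value : ∀ {Δ : List Sentence} (t : Term 0) → Deriv T Δ (t ≐ num (value t))
  ⊢-value zer      = ≐refl zer
  ⊢-value (S t)    = ≐-congS (⊢-value t)
  ⊢-value (s +' t) = ≐-trans (≐-cong+ (⊢-value s) (⊢-value t)) (num-+ _ _)
  ⊢-value (s *' t) = ≐-trans (≐-cong* (⊢-value s) (⊢-value t)) (num-* _ _)

  ⊢-value-wkT : ∀ {Δ : List (Formula 1)} (u : Term 0) → Deriv T Δ (wkT u ≐ num (value u))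
  ⊢-value-wkT u = cast (cong₂ _≐_ (sym wkT-closed) (subT-num (λ ()) _)) (⊢-lift (λ ()) (⊢-value u))
    where
    wkT-closed : wkT u ≡ subT (λ ()) u
    wkT-closed = trans (renT-as-subT fs u) (subT-cong (λ ()) u)

  private
    +-at-zero : ∀ m {n} {Δ : List (Formula n)} (s t : Term n) {χ} → Deriv T Δ (s +' t ≐ num m) →
                Deriv T ((s ≐ num m) ∷ (t ≐ num 0) ∷ Δ) χ → Deriv T ((t ≐ zer) ∷ Δ) χ
    +-at-zero m s t e k = ⇒E (⇒E (weaken there (⇒I (⇒I k))) (hyp (here refl)))
      (≐-trans (≐-sym (≐-trans (≐-cong+ (≐refl s) (hyp (here refl))) (Q-+0 s))) (weaken there e))

    +-at-suc : ∀ m {n} {Δ : List (Formula n)} (s t : Term n) → Deriv T Δ (s +' t ≐ num m) →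
               Deriv T ((wkT t ≐ S (var fz)) ∷ map wk Δ) (S (wkT s +' var fz) ≐ num m)
    +-at-suc m s t e = ≐-trans (≐-sym (Q-+S (wkT s) (var fz)))
      (≐-trans (≐-cong+ (≐refl (wkT s)) (≐-sym (hyp (here refl))))
               (weaken there (cast (cong (_ ≐_) (renT-num fs m)) (Deriv-wk e))))

  +≐num-cases : ∀ m {n} {Δ : List (Formula n)} (s t : Term n) {χ} → Deriv T Δ (s +' t ≐ num m) →
                (∀ i j → i + j ≡ m → Deriv T ((s ≐ num i) ∷ (t ≐ num j) ∷ Δ) χ) → Deriv T Δ χ
  +≐num-cases zero s t e k = ∨E (Q-zero-or-succ t) (+-at-zero zero s t e (k 0 0 refl))
    (∃E (hyp (here refl)) (⊥E (⇒E (Q-S≢0 _) (+-at-suc zero s t (weaken there e)))))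
  +≐num-cases (suc m) {Δ = Δ} s t {χ} e k =
    ∨E (Q-zero-or-succ t) (+-at-zero (suc m) s t e (k (suc m) 0 (+-identityʳ _)))
    (∃E (hyp (here refl))
        (+≐num-cases m (wkT s) (var fz) (Q-S-injective (+-at-suc (suc m) s t (weaken there e))) k′))
    where
    -- t = S y and s + y = m, so a split i + j = m of s + y is the split i + (1 + j) of s + t.
    k′ : ∀ i j → i + j ≡ m →
         Deriv T ((wkT s ≐ num i) ∷ (var fz ≐ num j) ∷ (wkT t ≐ S (var fz)) ∷ map wk (_ ∷ Δ)) (wk χ)
    k′ i j p = ⇒E (⇒E (weaken (λ q → there (there (there (there q))))
                          (cast (cong₂ (λ a b → wkT t ≐ a ⇒̇ wkT s ≐ b ⇒̇ wk χ)
                                       (renT-num fs (suc j)) (renT-num fs i))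
                                (Deriv-wk (⇒I (⇒I (k i (suc j) (trans (+-suc i j) (cong suc p))))))))
                      (≐-trans (hyp (there (there (here refl)))) (≐-congS (hyp (there (here refl))))))
                  (hyp (here refl))

  ≤̇-cases : ∀ N {n} {Δ : List (Formula n)} (x u : Term n) {χ} → Deriv T Δ (x ≤̇ u) → Deriv T Δ (u ≐ num N) →
            (∀ j → j ≤ N → Deriv T ((x ≐ num j) ∷ Δ) χ) → Deriv T Δ χ
  ≤̇-cases N {Δ = Δ} x u {χ} d e k = ∃E d (+≐num-cases N (var fz) (wkT x) sum≐N continue)
    where
    sum≐N : Deriv T ((var fz +' wkT x ≐ wkT u) ∷ map wk Δ) (var fz +' wkT x ≐ num N)
    sum≐N = ≐-trans (hyp (here refl)) (weaken there (cast (cong (_ ≐_) (renT-num fs N)) (Deriv-wk e)))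
    continue : ∀ i j → i + j ≡ N →
               Deriv T ((var fz ≐ num i) ∷ (wkT x ≐ num j) ∷ (var fz +' wkT x ≐ wkT u) ∷ map wk Δ) (wk χ)
    continue i j p = ⇒E (weaken (λ q → there (there (there q)))
                          (cast (cong (λ a → wkT x ≐ a ⇒̇ wk χ) (renT-num fs j))
                                (Deriv-wk (⇒I (k j (subst (j ≤_) p (m≤n+m j i)))))))
                        (hyp (there (here refl)))

  ≤̇-intro : ∀ {a} (u : Term 0) → a ≤ value u → T ⊢ (num a ≤̇ u)
  ≤̇-intro {a} u a≤u with m≤n⇒∃[o]m+o≡n a≤u
  ... | c , a+c≡u = ∃I (num c)
    (cast (sym (cong₂ (λ x y → num c +' x ≐ y) (subT-sub0-wkT (num c) (num a)) (subT-sub0-wkT (num c) u)))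
          (≐-trans (num-+ c a) (≐-sym (cast-num (sym (trans (+-comm c a) a+c≡u)) (⊢-value u)))))

  ≤̇-[] : ∀ (u : Term 0) a → (var fz ≤̇ wkT u) [ num a ] ≡ (num a ≤̇ u)
  ≤̇-[] u a = trans (subF-≤̇ (sub0 (num a)) (var fz) (wkT u)) (cong (num a ≤̇_) (subT-sub0-wkT (num a) u))

  module _ (u : Term 0) (ψ : Formula 1) where

    ∀≤-intro : (∀ j → j ≤ value u → T ⊢ ψ [ num j ]) → T ⊢ ∀̇ ((var fz ≤̇ wkT u) ⇒̇ ψ)
    ∀≤-intro h = ∀I (⇒I (≤̇-cases (value u) (var fz) (wkT u) (hyp (here refl)) (⊢-value-wkT u)
      λ j j≤u → ≐num-instance ψ (hyp (here refl)) (h j j≤u)))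

    ∃≤-refute : (∀ j → j ≤ value u → T ⊢ ¬̇ (ψ [ num j ])) → T ⊢ ¬̇ ∃̇ ((var fz ≤̇ wkT u) ∧̇ ψ)
    ∃≤-refute h = ⇒I (∃E (hyp (here refl))
      (≤̇-cases (value u) (var fz) (wkT u) (∧E₁ (hyp (here refl))) (⊢-value-wkT u)
        λ j j≤u → ⇒E (≐num-instance (¬̇ ψ) (hyp (here refl)) (h j j≤u)) (∧E₂ (hyp (there (here refl))))))

    ∃≤-intro : ∀ {a} → a ≤ value u → T ⊢ ψ [ num a ] → T ⊢ ∃̇ ((var fz ≤̇ wkT u) ∧̇ ψ)
    ∃≤-intro {a} a≤u d = ∃I (num a) (∧I (cast (sym (≤̇-[] u a)) (≤̇-intro u a≤u)) d)

    ∀≤-refute : ∀ {a} → a ≤ value u → T ⊢ ¬̇ (ψ [ num a ]) → T ⊢ ¬̇ ∀̇ ((var fz ≤̇ wkT u) ⇒̇ ψ)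
    ∀≤-refute {a} a≤u d = ⇒I (⇒E (weaken₀ d)
      (⇒E (∀E (hyp (here refl)) (num a)) (cast (sym (≤̇-[] u a)) (weaken₀ (≤̇-intro u a≤u)))))

module Classical (lem : ExcludedMiddle 0ℓ) where

  dne : ∀ {P : Set} → ¬ ¬ P → P
  dne = em⇒dne lem

  ¬∀⇒∃¬ : ∀ {P : ℕ → Set} → ¬ (∀ a → P a) → ∃ λ a → ¬ P a
  ¬∀⇒∃¬ ¬∀ = dne λ ¬∃ → ¬∀ λ a → dne λ ¬Pa → ¬∃ (a , ¬Pa)

  ¬→⇒×¬ : ∀ {P Q : Set} → ¬ (P → Q) → P × ¬ Q
  ¬→⇒×¬ ¬P→Q = dne (λ ¬P → ¬P→Q (⊥-elim ∘ ¬P)) , λ q → ¬P→Q (λ _ → q)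

module Completeness (lem : ExcludedMiddle 0ℓ) {T : Theory} (T⊇Q : ExtendsQ T) where

  open Classical lem
  open Derivations T
  open Robinson T⊇Q

  true-Δ₀⇒provable   : ∀ {n} {φ : Formula n} → IsΔ₀ φ → ∀ ρ → ⟦ φ ⟧ ρ → T ⊢ inst ρ φ
  false-Δ₀⇒refutable : ∀ {n} {φ : Formula n} → IsΔ₀ φ → ∀ ρ → ¬ ⟦ φ ⟧ ρ → T ⊢ ¬̇ inst ρ φ

  true-Δ₀⇒provable (eq s t) ρ p = ≐-trans (cast-num s≡t (⊢-value _)) (≐-sym (⊢-value _))
    where
    s≡t : value (subT (numerals ρ) s) ≡ value (subT (numerals ρ) t)
    s≡t = trans (value-inst s ρ) (trans p (sym (value-inst t ρ)))
  true-Δ₀⇒provable bot ρ ()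
  true-Δ₀⇒provable (imp {φ} d₁ d₂) ρ f with lem {⟦ φ ⟧ ρ}
  ... | yes x = ⇒I (weaken₀ (true-Δ₀⇒provable d₂ ρ (f x)))
  ... | no ¬x = ⇒I (⊥E (⇒E (weaken₀ (false-Δ₀⇒refutable d₁ ρ ¬x)) (hyp (here refl))))
  true-Δ₀⇒provable (conj d₁ d₂) ρ (x , y)  = ∧I (true-Δ₀⇒provable d₁ ρ x) (true-Δ₀⇒provable d₂ ρ y)
  true-Δ₀⇒provable (disj d₁ d₂) ρ (inj₁ x) = ∨I₁ (true-Δ₀⇒provable d₁ ρ x)
  true-Δ₀⇒provable (disj d₁ d₂) ρ (inj₂ y) = ∨I₂ (true-Δ₀⇒provable d₂ ρ y)
  true-Δ₀⇒provable (ball t {ψ} d) ρ f = cast (sym (inst-∀≤ ρ t ψ))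
    (∀≤-intro _ _ λ j j≤t →
      cast (sym (inst-∷ₑ ψ j ρ)) (true-Δ₀⇒provable d (j ∷ₑ ρ) (f j (from (⟦≤̇⟧ t j ρ) j≤t))))
  true-Δ₀⇒provable (bex t {ψ} d) ρ (a , a≤t , x) = cast (sym (inst-∃≤ ρ t ψ))
    (∃≤-intro _ _ (to (⟦≤̇⟧ t a ρ) a≤t) (cast (sym (inst-∷ₑ ψ a ρ)) (true-Δ₀⇒provable d (a ∷ₑ ρ) x)))

  false-Δ₀⇒refutable (eq s t) ρ ¬p = ⇒I (⇒E (num-≢ _ _ s≢t)
      (≐-trans (≐-sym (⊢-value _)) (≐-trans (hyp (here refl)) (⊢-value _))))
    where
    s≢t : ¬ value (subT (numerals ρ) s) ≡ value (subT (numerals ρ) t)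
    s≢t q = ¬p (trans (sym (value-inst s ρ)) (trans q (value-inst t ρ)))
  false-Δ₀⇒refutable bot ρ _ = ⇒I (hyp (here refl))
  false-Δ₀⇒refutable (imp d₁ d₂) ρ ¬f with ¬→⇒×¬ ¬f
  ... | x , ¬y = ⇒I (⇒E (weaken₀ (false-Δ₀⇒refutable d₂ ρ ¬y))
                        (⇒E (hyp (here refl)) (weaken₀ (true-Δ₀⇒provable d₁ ρ x))))
  false-Δ₀⇒refutable (conj {φ} d₁ d₂) ρ ¬f with lem {⟦ φ ⟧ ρ}
  ... | yes x = ⇒I (⇒E (weaken₀ (false-Δ₀⇒refutable d₂ ρ (λ y → ¬f (x , y)))) (∧E₂ (hyp (here refl))))
  ... | no ¬x = ⇒I (⇒E (weaken₀ (false-Δ₀⇒refutable d₁ ρ ¬x)) (∧E₁ (hyp (here refl))))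
  false-Δ₀⇒refutable (disj d₁ d₂) ρ ¬f = ⇒I (∨E (hyp (here refl))
      (⇒E (weaken₀ (false-Δ₀⇒refutable d₁ ρ (¬f ∘ inj₁))) (hyp (here refl)))
      (⇒E (weaken₀ (false-Δ₀⇒refutable d₂ ρ (¬f ∘ inj₂))) (hyp (here refl))))
  false-Δ₀⇒refutable (ball t {ψ} d) ρ ¬f with ¬∀⇒∃¬ ¬f
  ... | a , ¬fa with ¬→⇒×¬ ¬fa
  ... | a≤t , ¬x = cast (cong ¬̇_ (sym (inst-∀≤ ρ t ψ)))
    (∀≤-refute _ _ (to (⟦≤̇⟧ t a ρ) a≤t)
      (cast (cong ¬̇_ (sym (inst-∷ₑ ψ a ρ))) (false-Δ₀⇒refutable d (a ∷ₑ ρ) ¬x)))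
  false-Δ₀⇒refutable (bex t {ψ} d) ρ ¬f = cast (cong ¬̇_ (sym (inst-∃≤ ρ t ψ)))
    (∃≤-refute _ _ λ j j≤t → cast (cong ¬̇_ (sym (inst-∷ₑ ψ j ρ)))
      (false-Δ₀⇒refutable d (j ∷ₑ ρ) (λ x → ¬f (j , from (⟦≤̇⟧ t j ρ) j≤t , x))))

  false-Π₁⇒refutable : ∀ {n} {φ : Formula n} → IsΠ 1 φ → ∀ ρ → ¬ ⟦ φ ⟧ ρ → T ⊢ ¬̇ inst ρ φ
  false-Π₁⇒refutable (ΣΠ (Δ₀Σ d)) = false-Δ₀⇒refutable d
  false-Π₁⇒refutable (∀Π {φ = ψ} q) ρ ¬f with ¬∀⇒∃¬ ¬f
  ... | a , ¬fa = ⇒I (⇒E (weaken₀ (false-Π₁⇒refutable q (a ∷ₑ ρ) ¬fa))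
                         (cast (inst-∷ₑ ψ a ρ) (∀E (hyp (here refl)) (num a))))

-- NoWitness p (k, x̄) says that k codes no witness of φ(x̄): for φ = ∃y ψ(y, x̄), no splitting
-- k = i + j makes i a witness for y with j coding a witness of ψ(i, x̄).
NoWitness : ∀ {n} {φ : Formula n} → IsΣ 2 φ → Formula (suc n)
NoWitness (ΠΣ {φ = φ} _) = ¬̇ wk φ
NoWitness (∃Σ q) =
  ∀̇ (∀̇ ((var (fs fz) +' var fz ≐ var (fs (fs fz))) ⇒̇ renF (ext (ext fs)) (NoWitness q)))

inst-NoWitness-∃ : ∀ {n} {ψ : Formula (suc n)} (q : IsΣ 2 ψ) (ρ : Fin n → ℕ) k →
                   inst (k ∷ₑ ρ) (NoWitness (∃Σ q))
                   ≡ ∀̇ (∀̇ ((var (fs fz) +' var fz ≐ num k)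
                           ⇒̇ subF (var fz ∷ₜ var (fs fz) ∷ₜ num ∘ ρ) (NoWitness q)))
inst-NoWitness-∃ q ρ k = cong (λ X → ∀̇ (∀̇ X)) (cong₂ _⇒̇_
  (cong (_ ≐_) (wk²-num k))
  (subF-renF-fuse (NoWitness q) λ { fz → refl ; (fs fz) → refl ; (fs (fs i)) → wk²-num (ρ i) }))
  where
  wk²-num : ∀ a → wkT (wkT (num {0} a)) ≡ num a
  wk²-num a = trans (cong wkT (renT-num fs a)) (renT-num fs a)

module _ {T : Theory} where

  open Derivations T

  ⊢Σ₂⇒∃¬NoWitness : ∀ {n} {φ : Formula n} (p : IsΣ 2 φ) → Deriv T [] (φ ⇒̇ ∃̇ (¬̇ NoWitness p))
  ⊢Σ₂⇒∃¬NoWitness (ΠΣ {φ = φ} _) = ⇒I (∃I zer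
    (cast (cong (λ X → ¬̇ ¬̇ X) (sym (subF-sub0-wk zer φ)))
          (⇒I (⇒E (hyp (here refl)) (hyp (there (here refl)))))))
  ⊢Σ₂⇒∃¬NoWitness {n} (∃Σ {φ = ψ} q) = ⇒I (∃E (hyp (here refl))
    (∃E (⇒E (weaken (λ ()) (⊢Σ₂⇒∃¬NoWitness q)) (hyp (here refl)))
        (cast (cong (λ X → ∃̇ (¬̇ (∀̇ (∀̇ ((var (fs fz) +' var fz ≐ var (fs (fs fz))) ⇒̇ X))))) (sym wk²-NoWitness))
              split-witness)))
    where
    D : Formula (suc (suc n))
    D = NoWitness q
    shift : Fin (suc (suc n)) → Term (suc (suc (suc (suc (suc n)))))
    shift = var fz ∷ₜ var (fs fz) ∷ₜ var ∘ fs ∘ fs ∘ fs ∘ fs ∘ fs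
    wk²-NoWitness : renF (ext (ext (ext fs))) (renF (ext (ext (ext fs))) (renF (ext (ext fs)) D)) ≡ subF shift D
    wk²-NoWitness = trans (renF-as-subF _ _)
      (trans (subF-renF-fuse _ (λ _ → refl))
             (subF-renF-fuse D λ { fz → refl ; (fs fz) → refl ; (fs (fs i)) → refl }))
    instance-at-split : subF (sub0 (var fz)) (subF (exts (sub0 (var (fs fz))))
                          (subF (exts (exts (sub0 (var (fs fz) +' var fz)))) (subF shift D))) ≡ D
    instance-at-split = trans (cong (subF _) (trans (cong (subF _) (subF-subF _ shift D)) (subF-subF _ _ D)))
      (trans (subF-subF _ _ D) (subF-var (λ { fz → refl ; (fs fz) → refl ; (fs (fs i)) → refl }) D))
    -- the witness y (variable 1) and the code j (variable 0) of the inner witness combine into k = y + j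
    split-witness : Deriv T ((¬̇ D) ∷ map wk (ψ ∷ map wk (∃̇ ψ ∷ [])))
      (∃̇ (¬̇ (∀̇ (∀̇ ((var (fs fz) +' var fz ≐ var (fs (fs fz))) ⇒̇ subF shift D)))))
    split-witness = ∃I (var (fs fz) +' var fz) (⇒I (⇒E (hyp (there (here refl)))
      (⇒E (cast (cong (_ ⇒̇_) instance-at-split) (∀E (∀E (hyp (here refl)) (var (fs fz))) (var fz)))
          (≐refl (var (fs fz) +' var fz)))))

record ωRefutation (T : Theory) (P : Sentence) : Set where
  field
    family    : Formula 1
    instances : (k : ℕ) → T ⊢ family [ num k ]
    refutes   : T ⊢ (P ⇒̇ ∃̇ (¬̇ family))

module _ {T : Theory} where

  open Derivations T

  ωConsistent⇒unprovable : ∀ {P} → ωConsistent T → ωRefutation T P → ¬ (T ⊢ P)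
  ωConsistent⇒unprovable ω r d = ω (family , ⇒E refutes d , instances)
    where open ωRefutation r

  ωRefutation-⊥̇ : ωRefutation T ⊥̇
  ωRefutation-⊥̇ = record
    { family = zer ≐ zer ; instances = λ _ → ≐refl zer ; refutes = ⇒I (⊥E (hyp (here refl))) }

  ∃¬-mono : ∀ {Δ : List Sentence} {D E : Formula 1} → (∀ {Γ : List (Formula 1)} → Deriv T Γ (E ⇒̇ D)) →
            Deriv T Δ (∃̇ (¬̇ D)) → Deriv T Δ (∃̇ (¬̇ E))
  ∃¬-mono {E = E} E⇒D d = ∃E d (∃I (var fz) (cast (cong ¬̇_ (sym E-at-var))
    (⇒I (⇒E (hyp (there (here refl))) (⇒E E⇒D (hyp (here refl)))))))
    where
    E-at-var : subF (sub0 (var fz)) (renF (ext fs) E) ≡ E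
    E-at-var = trans (subF-renF-fuse E λ { fz → refl ; (fs ()) }) (subF-var (λ _ → refl) E)

  ωRefutation-∨ : ∀ {P R} → ωRefutation T P → ωRefutation T R → ωRefutation T (P ∨̇ R)
  ωRefutation-∨ r s = record
    { family    = r.family ∧̇ s.family
    ; instances = λ k → ∧I (r.instances k) (s.instances k)
    ; refutes   = ⇒I (∨E (hyp (here refl))
        (∃¬-mono (⇒I (∧E₁ (hyp (here refl)))) (⇒E (weaken₀ r.refutes) (hyp (here refl))))
        (∃¬-mono (⇒I (∧E₂ (hyp (here refl)))) (⇒E (weaken₀ s.refutes) (hyp (here refl)))))
    }
    where
    module r = ωRefutation r
    module s = ωRefutation s

module FalseΣ₂ (lem : ExcludedMiddle 0ℓ) {T : Theory} (T⊇Q : ExtendsQ T) where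

  open Derivations T
  open Robinson T⊇Q
  open Completeness lem T⊇Q

  false-Σ₂⇒⊢NoWitness : ∀ {n} {φ : Formula n} (p : IsΣ 2 φ) ρ → ¬ ⟦ φ ⟧ ρ →
                        ∀ k → T ⊢ inst (k ∷ₑ ρ) (NoWitness p)
  false-Σ₂⇒⊢NoWitness (ΠΣ {φ = φ} q) ρ ¬f k =
    cast (cong ¬̇_ (sym (subF-renF-fuse φ (λ _ → refl)))) (false-Π₁⇒refutable q ρ ¬f)
  false-Σ₂⇒⊢NoWitness (∃Σ q) ρ ¬f k = cast (sym (inst-NoWitness-∃ q ρ k))
    (∀I (∀I (⇒I (+≐num-cases k (var (fs fz)) (var fz) (hyp (here refl)) λ i j _ →
      ≐num-instance₂ (NoWitness q) ρ (hyp (here refl)) (hyp (there (here refl)))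
        (false-Σ₂⇒⊢NoWitness q (i ∷ₑ ρ) (¬f ∘ (i ,_)) j)))))

  false-Σ₂⇒ωRefutation : ∀ {n} {φ : Formula n} → IsΣ 2 φ → ∀ ρ → ¬ ⟦ φ ⟧ ρ → ωRefutation T (inst ρ φ)
  false-Σ₂⇒ωRefutation p ρ ¬f = record
    { family    = subF (exts (numerals ρ)) (NoWitness p)
    ; instances = λ k → cast (sym (inst-∷ₑ (NoWitness p) k ρ)) (false-Σ₂⇒⊢NoWitness p ρ ¬f k)
    ; refutes   = Deriv-subF (numerals ρ) (λ ()) (⊢Σ₂⇒∃¬NoWitness p)
    }

Σ₁⇒Σ₂ : ∀ {n} {φ : Formula n} → IsΣ 1 φ → IsΣ 2 φ
Σ₁⇒Σ₂ (ΠΣ (Δ₀Π d)) = ΠΣ (ΣΠ (Δ₀Σ d))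
Σ₁⇒Σ₂ (∃Σ q)        = ∃Σ (Σ₁⇒Σ₂ q)

module Soundness (lem : ExcludedMiddle 0ℓ) {T : Theory} (ω : ωConsistent T) (T⊇Q : ExtendsQ T) where

  open Classical lem
  open Derivations T
  open FalseΣ₂ lem T⊇Q

  -- The ω-refutable disjunct P is what lets the argument reach Gödelian sentences,
  -- of which T only proves G ∨ Pr(#G).
  Π₃-sound : ∀ {n} {φ : Formula n} → IsΠ 3 φ → ∀ ρ {P} → ωRefutation T P → T ⊢ (inst ρ φ ∨̇ P) → ⟦ φ ⟧ ρ
  Π₃-sound (ΣΠ q) ρ r d = dne λ ¬f →
    ωConsistent⇒unprovable ω (ωRefutation-∨ (false-Σ₂⇒ωRefutation q ρ ¬f) r) d
  Π₃-sound (∀Π {φ = ψ} q) ρ r d a = Π₃-sound q (a ∷ₑ ρ) r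
    (∨E d (∨I₁ (cast (inst-∷ₑ ψ a ρ) (∀E (hyp (here refl)) (num a)))) (∨I₂ (hyp (here refl))))

  Π₃-sentence-sound : ∀ {σ P} → IsΠ 3 σ → ωRefutation T P → T ⊢ (σ ∨̇ P) → TrueInℕ σ
  Π₃-sentence-sound {σ} {P} p r d =
    ⟦⟧-cong σ (λ ()) (Π₃-sound p emptyₑ r (cast (cong (_∨̇ P) (sym (subF-var (λ ()) σ))) d))

  Π₃-provable⇒true : (σ : Sentence) → IsΠ 3 σ → T ⊢ σ → TrueInℕ σ
  Π₃-provable⇒true σ p d = Π₃-sentence-sound p ωRefutation-⊥̇ (∨I₁ d)

  Π₃-Gödelian⇒true : (Pr : Formula 1) → IsProvabilityPredicate T Pr →
                     (G : Sentence) → Gödelian T Pr G → IsΠ 3 G → TrueInℕ G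
  Π₃-Gödelian⇒true Pr (Pr-Σ₁ , Pr-defines) G g p = dne λ ¬G →
    ¬G (Π₃-sentence-sound p (Pr[#G]-ωRefutation ¬G) (⇔¬⇒∨ g))
    where
    Pr[#G]-ωRefutation : ¬ TrueInℕ G → ωRefutation T (Pr [ # G ])
    Pr[#G]-ωRefutation ¬G = subst (ωRefutation T) (subF-cong (λ { fz → refl ; (fs ()) }) Pr)
      (false-Σ₂⇒ωRefutation (Σ₁⇒Σ₂ Pr-Σ₁) (⌜ G ⌝ ∷ₑ emptyₑ) λ x →
        ¬G (Π₃-provable⇒true G p (proj₂ (Pr-defines G)
          (from (⟦subF⟧ Pr (sub0 (# G)) λ { fz → ⟦num⟧ _ _ ; (fs ()) }) x))))

proposition3 : ExcludedMiddle 0ℓ →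
    (T : Theory) → ωConsistent T → RecursivelyEnumerable T → ExtendsQ T →
    ((σ : Sentence) → IsΠ 3 σ → T ⊢ σ → TrueInℕ σ)
    × ((Pr : Formula 1) → IsProvabilityPredicate T Pr →
       (G : Sentence) → Gödelian T Pr G → IsΠ 3 G → TrueInℕ G)
proposition3 lem T ω _ T⊇Q = Π₃-provable⇒true , Π₃-Gödelian⇒true
  where open Soundness lem ω T⊇Q
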